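{- Let $q>7$ be a prime and $a$ a positive integer. Then $$\nu_q\Big(\prod_{p\le a}(p-1)\Big)\le \frac{0.23\,a}{q-1}+\frac{7\log a}{\log q},$$ where the product runs over primes $p\le a$.
   Context: For a prime $q$ and a nonzero integer $n$, $\nu_q(n)$ denotes the exponent of $q$ in the prime factorisation of $n$. -}

module Defs where

open import Data.Nat using (ℕ; zero; suc; _+_; _*_; _∸_; _^_; _≤_)
open import Data.Nat.Divisibility using (_∣_)
open import Data.Nat.Primality using (prime?)
open import Data.Product using (_×_)
open import Data.Sum using (_⊎_)
open import Relation.Nullary using (¬_; yes; no)

-- ∏_{p ≤ a, p prime} (p - 1).  For p = suc n the factor p - 1 is n.
primeProd : ℕ → ℕ
primeProd zero = 1
primeProd (suc n) with prime? (suc n)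
... | yes _ = n * primeProd n
... | no  _ = primeProd n

IsValuation : ℕ → ℕ → ℕ → Set
IsValuation q n k = (q ^ k ∣ n) × ¬ (q ^ suc k ∣ n)

-- Exact integer encoding of the real inequality
--   k ≤ 0.23 a / (q-1) + 7 log a / log q      (for q ≥ 2, a ≥ 1):
-- with N = 100(q-1)k, M = 23a, D = 100(q-1) it is
--   N ≤ M  or  (N - M) log q ≤ 7 D log a,  i.e.  q^(N-M) ≤ a^(7D).
ValBound : ℕ → ℕ → ℕ → Set
ValBound q a k =
  (100 * (q ∸ 1) * k ≤ 23 * a) ⊎
  (q ^ (100 * (q ∸ 1) * k ∸ 23 * a) ≤ a ^ (7 * (100 * (q ∸ 1))))

-- ν_q(∏ (p - 1)) = Σ_{j ≥ 1} #{p ≤ a prime : q^j ∣ p - 1}, and only j ≤ J contribute, where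
-- q^J ≤ a < q^(J+1).  A prime p = 1 + m q^j counted here exceeds 7, so it is coprime to
-- 210 = 2·3·5·7; as q^j is itself coprime to 210, whether 1 + m q^j is coprime to 210
-- depends only on m mod 210, with 48 = φ(210) hits per period.  An exhaustive check over
-- the residues u of q^j mod 210 bounds the hits for m ≤ r by (48 r + 426) / 210.  Summing
-- over j with Σ_j ⌊(a-1)/q^j⌋ ≤ (a-1)/(q-1) gives 210 (q-1) ν ≤ 48 a + 426 (q-1) J, and
-- 48/210 < 0.23, 426/210 < 7, J ≤ log a / log q.
module Submission where

open import Defs
open import Data.Bool.Base using (Bool; true; false; T; _∧_)
open import Data.Bool.Properties using (T-∧; T-≡)
open import Data.Fin.Base using (Fin; zero; suc; toℕ)
open import Data.Nat.Base
open import Data.Nat.Divisibility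
open import Data.Nat.DivMod
open import Data.Nat.Primality
  using (Prime; prime?; prime[2]; ¬prime[1]; euclidsLemma; prime⇒irreducible; prime⇒nonZero; prime⇒nonTrivial)
open import Data.Nat.Properties
open import Algebra.Properties.CommutativeSemigroup *-commutativeSemigroup
  using (xy∙z≈y∙xz; x∙yz≈z∙xy)
import Algebra.Properties.CommutativeSemigroup +-commutativeSemigroup as +-CS
open import Algebra.Properties.Semiring.Sum +-*-semiring
  using (sum; sum-syntax; sum-cong-≗; ∑-distrib-+; *-distribˡ-sum)
open import Data.Nat.Tactic.RingSolver using (solve-∀)
open import Data.Product.Base using (_,_; proj₁; proj₂; ∃-syntax; _×_)
open import Data.Sum.Base using (inj₁; inj₂)
open import Data.Unit.Base using (tt)
open import Data.Vec.Functional using (Vector)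
open import Function.Base using (_∘_)
open import Function.Bundles using (_⇔_; mk⇔; Equivalence)
open import Relation.Binary.PropositionalEquality
open import Relation.Nullary using (¬_; contradiction; does; yes; no)
open import Relation.Nullary.Decidable using (dec-true; does-⇔; from-yes; toWitness; T?; _→-dec_)

𝟙 : Bool → ℕ
𝟙 true  = 1
𝟙 false = 0

sum-mono-≤ : ∀ {J} {f g : Vector ℕ J} → (∀ j → f j ≤ g j) → sum f ≤ sum g
sum-mono-≤ {zero}  f≤g = z≤n
sum-mono-≤ {suc J} f≤g = +-mono-≤ (f≤g zero) (sum-mono-≤ (f≤g ∘ suc))

sum-const : ∀ J c → ∑[ j < J ] c ≡ J * c
sum-const zero    c = refl
sum-const (suc J) c = cong (c +_) (sum-const J c)

ValuationAtMost : ℕ → ℕ → ℕ → Set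
ValuationAtMost q n B = ∀ k → q ^ k ∣ n → k ≤ B

powerDivisorCount : ℕ → ℕ → ℕ → ℕ
powerDivisorCount q J x = ∑[ j < J ] 𝟙 (does (q ^ suc (toℕ j) ∣? x))

module _ {q : ℕ} .{{_ : NonZero q}} where

  ∣⇒q^1∣ : ∀ {x} → q ∣ x → q ^ 1 ∣ x
  ∣⇒q^1∣ {x} = subst (_∣ x) (sym (*-identityʳ q))

  q^suc∣*q⇔ : ∀ {j y} → q ^ suc j ∣ y * q ⇔ q ^ j ∣ y
  q^suc∣*q⇔ {j} {y} = mk⇔
    (λ h → *-cancelʳ-∣ q (subst (_∣ y * q) (*-comm q (q ^ j)) h))
    (λ h → subst (_∣ y * q) (*-comm (q ^ j) q) (*-monoˡ-∣ q h))

  ∤⇒valuationAtMost-0 : ∀ {x} → ¬ q ∣ x → ValuationAtMost q x 0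
  ∤⇒valuationAtMost-0 q∤x zero    _      = z≤n
  ∤⇒valuationAtMost-0 q∤x (suc k) qᵏ⁺¹∣x = contradiction (∣-trans (m∣m*n (q ^ k)) qᵏ⁺¹∣x) q∤x

  valuationAtMost-*q : ∀ {x B} → ValuationAtMost q x B → ValuationAtMost q (x * q) (suc B)
  valuationAtMost-*q ν zero    _        = z≤n
  valuationAtMost-*q ν (suc k) qᵏ⁺¹∣xq = s≤s (ν k (Equivalence.to (q^suc∣*q⇔ {k}) qᵏ⁺¹∣xq))

  valuationAtMost-*q⁻¹ : ∀ {x B} → ValuationAtMost q (x * q) B →
                         ∃[ B′ ] B ≡ suc B′ × ValuationAtMost q x B′
  valuationAtMost-*q⁻¹ {x} {suc B′} ν = B′ , refl , λ k qᵏ∣x →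
    s≤s⁻¹ (ν (suc k) (Equivalence.from (q^suc∣*q⇔ {k}) qᵏ∣x))
  valuationAtMost-*q⁻¹ {x} {zero}   ν = contradiction (ν 1 (∣⇒q^1∣ (n∣m*n x))) λ ()

  powerDivisorCount-*q : ∀ J y → powerDivisorCount q (suc J) (y * q) ≡ suc (powerDivisorCount q J y)
  powerDivisorCount-*q J y = cong₂ _+_
    (cong 𝟙 (dec-true (q ^ 1 ∣? y * q) (∣⇒q^1∣ (n∣m*n y))))
    (sum-cong-≗ {J} λ j → cong 𝟙
      (does-⇔ (q^suc∣*q⇔ {suc (toℕ j)}) (q ^ suc (suc (toℕ j)) ∣? y * q) (q ^ suc (toℕ j) ∣? y)))

  valuationAtMost-powerDivisorCount : ∀ J {x} → 0 < x → x < q ^ suc J →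
                                      ValuationAtMost q x (powerDivisorCount q J x)
  valuationAtMost-powerDivisorCount J {x} 0<x x<qᴶ⁺¹ with q ∣? x
  ... | no q∤x = λ k qᵏ∣x → ≤-trans (∤⇒valuationAtMost-0 q∤x k qᵏ∣x) z≤n
  ... | yes (divides (suc y) refl) with J
  ...   | zero  = contradiction x<qᴶ⁺¹ (≤⇒≯ (subst (_≤ suc y * q) (sym (*-identityʳ q)) (m≤m+n q (y * q))))
  ...   | suc J = subst (ValuationAtMost q (suc y * q)) (sym (powerDivisorCount-*q J (suc y)))
                    (valuationAtMost-*q (valuationAtMost-powerDivisorCount J z<s y<qᴶ⁺¹))
    where
    y<qᴶ⁺¹ : suc y < q ^ suc J
    y<qᴶ⁺¹ = *-cancelʳ-< _ (suc y) (q ^ suc J) (subst (suc y * q <_) (*-comm q (q ^ suc J)) x<qᴶ⁺¹)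

primesCount : ℕ → ℕ → ℕ
primesCount Q zero = 0
primesCount Q (suc n) with prime? (suc n)
... | yes _ = 𝟙 (does (Q ∣? n)) + primesCount Q n
... | no  _ = primesCount Q n

module _ {q : ℕ} (q-prime : Prime q) where

  private instance
    q-nonZero : NonZero q
    q-nonZero = prime⇒nonZero q-prime

  valuationAtMost-* : ∀ {m n A B} → ValuationAtMost q m A → ValuationAtMost q n B →
                      ValuationAtMost q (m * n) (A + B)
  valuationAtMost-* _ _ zero _ = z≤n
  valuationAtMost-* {m} {n} νm νn (suc k) qᵏ⁺¹∣mn
    with euclidsLemma m n q-prime (∣-trans (m∣m*n (q ^ k)) qᵏ⁺¹∣mn)
  ... | inj₁ (divides m′ refl) with valuationAtMost-*q⁻¹ {x = m′} νm
  ...   | A′ , refl , νm′ = s≤s (valuationAtMost-* νm′ νn k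
            (*-cancelˡ-∣ q (subst (q ^ suc k ∣_) (xy∙z≈y∙xz m′ q n) qᵏ⁺¹∣mn)))
  valuationAtMost-* {m} {n} νm νn (suc k) qᵏ⁺¹∣mn
      | inj₂ (divides n′ refl) with valuationAtMost-*q⁻¹ {x = n′} νn
  ...   | B′ , refl , νn′ = subst (suc k ≤_) (sym (+-suc _ B′)) (s≤s (valuationAtMost-* νm νn′ k
            (*-cancelˡ-∣ q (subst (q ^ suc k ∣_) (x∙yz≈z∙xy m n′ q) qᵏ⁺¹∣mn))))

  primeProd-valuationAtMost : ∀ J a → a < q ^ suc J →
    ValuationAtMost q (primeProd a) (∑[ j < J ] primesCount (q ^ suc (toℕ j)) a)
  primeProd-valuationAtMost J zero    _ k qᵏ∣1 =
    ≤-trans (∤⇒valuationAtMost-0 (nonTrivial⇒≢1 {{prime⇒nonTrivial q-prime}} ∘ ∣1⇒≡1) k qᵏ∣1) z≤n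
  primeProd-valuationAtMost J (suc n) a<qᴶ⁺¹ with prime? (suc n)
  ... | yes p = subst (ValuationAtMost q (n * primeProd n)) (sym (∑-distrib-+ powerDivides count))
    (valuationAtMost-* (valuationAtMost-powerDivisorCount J (n≢0⇒n>0 λ { refl → ¬prime[1] p }) n<qᴶ⁺¹)
                       (primeProd-valuationAtMost J n n<qᴶ⁺¹))
    where
    n<qᴶ⁺¹ = <-trans (n<1+n n) a<qᴶ⁺¹
    powerDivides count : Fin J → ℕ
    powerDivides j = 𝟙 (does (q ^ suc (toℕ j) ∣? n))
    count        j = primesCount (q ^ suc (toℕ j)) n
  ... | no  _ = primeProd-valuationAtMost J n (<-trans (n<1+n n) a<qᴶ⁺¹)

coprimeTo210ᵇ : ℕ → Bool
coprimeTo210ᵇ x = (0 <ᵇ x % 2) ∧ (0 <ᵇ x % 3) ∧ (0 <ᵇ x % 5) ∧ (0 <ᵇ x % 7)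

coprimeTo210ᵇ-intro : ∀ {x} → (∀ {d} → Prime d → d ≤ 7 → ¬ d ∣ x) → T (coprimeTo210ᵇ x)
coprimeTo210ᵇ-intro {x} d∤x = Equivalence.from T-∧
  (coprime-to 2 prime[2] tt , Equivalence.from T-∧
  (coprime-to 3 (from-yes (prime? 3)) tt , Equivalence.from T-∧
  (coprime-to 5 (from-yes (prime? 5)) tt , coprime-to 7 (from-yes (prime? 7)) tt)))
  where
  coprime-to : ∀ d .{{_ : NonZero d}} → Prime d → T (d ≤ᵇ 7) → T (0 <ᵇ x % d)
  coprime-to d p d≤7 = <⇒<ᵇ (n≢0⇒n>0 (d∤x p (≤ᵇ⇒≤ d 7 d≤7) ∘ m%n≡0⇒n∣m x d))

prime∣prime^⇒≡ : ∀ {d p} → Prime d → Prime p → ∀ j → d ∣ p ^ j → d ≡ p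
prime∣prime^⇒≡ d-prime p-prime zero    d∣1 = contradiction (subst Prime (∣1⇒≡1 d∣1) d-prime) ¬prime[1]
prime∣prime^⇒≡ {d} {p} d-prime p-prime (suc j) d∣pʲ⁺¹ with euclidsLemma p (p ^ j) d-prime d∣pʲ⁺¹
... | inj₂ d∣pʲ = prime∣prime^⇒≡ d-prime p-prime j d∣pʲ
... | inj₁ d∣p with prime⇒irreducible p-prime d∣p
...   | inj₁ refl = contradiction d-prime ¬prime[1]
...   | inj₂ d≡p  = d≡p

coprimeTo210ᵇ-prime^ : ∀ {p} → Prime p → 7 < p → ∀ j → T (coprimeTo210ᵇ (p ^ j))
coprimeTo210ᵇ-prime^ p-prime 7<p j = coprimeTo210ᵇ-intro λ d-prime d≤7 d∣pʲ →
  <⇒≱ 7<p (subst (_≤ 7) (prime∣prime^⇒≡ d-prime p-prime j d∣pʲ) d≤7)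

coprimeTo210ᵇ-prime : ∀ {p} → Prime p → 7 < p → T (coprimeTo210ᵇ p)
coprimeTo210ᵇ-prime {p} p-prime 7<p = subst (T ∘ coprimeTo210ᵇ) (*-identityʳ p) (coprimeTo210ᵇ-prime^ p-prime 7<p 1)

[m+k[ln]]%n≡m%n : ∀ m k l n .{{_ : NonZero n}} → (m + k * (l * n)) % n ≡ m % n
[m+k[ln]]%n≡m%n m k l n = trans (cong (λ t → (m + t) % n) (sym (*-assoc k l n))) ([m+kn]%n≡m%n m (k * l) n)

coprimeTo210ᵇ-periodic : ∀ x k → coprimeTo210ᵇ (x + k * 210) ≡ coprimeTo210ᵇ x
coprimeTo210ᵇ-periodic x k
  rewrite [m+k[ln]]%n≡m%n x k 105 2 ⦃ _ ⦄ | [m+k[ln]]%n≡m%n x k 70 3 ⦃ _ ⦄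
        | [m+k[ln]]%n≡m%n x k 42 5 ⦃ _ ⦄  | [m+k[ln]]%n≡m%n x k 30 7 ⦃ _ ⦄ = refl

coprimeTo210ᵇ-%210 : ∀ x → coprimeTo210ᵇ x ≡ coprimeTo210ᵇ (x % 210)
coprimeTo210ᵇ-%210 x =
  trans (cong coprimeTo210ᵇ (m≡m%n+[m/n]*n x 210)) (coprimeTo210ᵇ-periodic (x % 210) (x / 210))

coprimeTo210ᵇ-1+m*u : ∀ m u → coprimeTo210ᵇ (1 + m * u) ≡ coprimeTo210ᵇ (1 + m * (u % 210))
coprimeTo210ᵇ-1+m*u m u = begin
  coprimeTo210ᵇ (1 + m * u)
    ≡⟨ cong (λ v → coprimeTo210ᵇ (1 + m * v)) (m≡m%n+[m/n]*n u 210) ⟩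
  coprimeTo210ᵇ (1 + m * (u % 210 + u / 210 * 210))
    ≡⟨ cong coprimeTo210ᵇ (expand m (u % 210) (u / 210)) ⟩
  coprimeTo210ᵇ (1 + m * (u % 210) + m * (u / 210) * 210)
    ≡⟨ coprimeTo210ᵇ-periodic (1 + m * (u % 210)) (m * (u / 210)) ⟩
  coprimeTo210ᵇ (1 + m * (u % 210))
    ∎
  where
  open ≡-Reasoning
  expand : ∀ m a b → 1 + m * (a + b * 210) ≡ 1 + m * a + m * b * 210
  expand = solve-∀

coprimeCount : ℕ → ℕ → ℕ
coprimeCount u zero    = 0
coprimeCount u (suc r) = 𝟙 (coprimeTo210ᵇ (1 + suc r * u)) + coprimeCount u r

coprimeCount-mono : ∀ u {r s} → r ≤ s → coprimeCount u r ≤ coprimeCount u s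
coprimeCount-mono u {s = zero}  z≤n = z≤n
coprimeCount-mono u {r} {suc s} r≤1+s with m≤n⇒m<n∨m≡n r≤1+s
... | inj₁ r<1+s = ≤-trans (coprimeCount-mono u (s≤s⁻¹ r<1+s)) (m≤n+m _ _)
... | inj₂ refl  = ≤-refl

coprimeCount-%210 : ∀ u r → coprimeCount u r ≡ coprimeCount (u % 210) r
coprimeCount-%210 u zero    = refl
coprimeCount-%210 u (suc r) = cong₂ _+_ (cong 𝟙 (coprimeTo210ᵇ-1+m*u (suc r) u)) (coprimeCount-%210 u r)

coprimeCount-210+ : ∀ u r → coprimeCount u (210 + r) ≡ coprimeCount u 210 + coprimeCount u r
coprimeCount-210+ u zero    = sym (+-identityʳ _)
coprimeCount-210+ u (suc r) = begin
  𝟙 (coprimeTo210ᵇ (1 + suc (210 + r) * u)) + coprimeCount u (210 + r)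
    ≡⟨ cong₂ (λ b c → 𝟙 b + c) shift (coprimeCount-210+ u r) ⟩
  𝟙 (coprimeTo210ᵇ (1 + suc r * u)) + (coprimeCount u 210 + coprimeCount u r)
    ≡⟨ +-CS.x∙yz≈y∙xz (𝟙 (coprimeTo210ᵇ (1 + suc r * u))) (coprimeCount u 210) (coprimeCount u r) ⟩
  coprimeCount u 210 + coprimeCount u (suc r) ∎
  where
  open ≡-Reasoning
  shift : coprimeTo210ᵇ (1 + suc (210 + r) * u) ≡ coprimeTo210ᵇ (1 + suc r * u)
  shift = trans (cong coprimeTo210ᵇ (expand r u)) (coprimeTo210ᵇ-periodic (1 + suc r * u) u)
    where
    expand : ∀ r u → 1 + suc (210 + r) * u ≡ 1 + suc r * u + u * 210
    expand = solve-∀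

coprimeCount-periodic : ∀ u → coprimeCount u 210 ≡ 48 →
                        ∀ t r → coprimeCount u (t * 210 + r) ≡ t * 48 + coprimeCount u r
coprimeCount-periodic u count≡48 zero    r = refl
coprimeCount-periodic u count≡48 (suc t) r = begin
  coprimeCount u (210 + (t * 210 + r))              ≡⟨ coprimeCount-210+ u (t * 210 + r) ⟩
  coprimeCount u 210 + coprimeCount u (t * 210 + r) ≡⟨ cong₂ _+_ count≡48 (coprimeCount-periodic u count≡48 t r) ⟩
  48 + (t * 48 + coprimeCount u r)                  ≡⟨ +-assoc 48 (t * 48) _ ⟨
  suc t * 48 + coprimeCount u r                     ∎
  where open ≡-Reasoning

-- 426 absorbs the excess of 210 · count over 48 r within one period; coprimeCount-table checks it.
CountBound : ℕ → ℕ → Set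
CountBound u r = 210 * coprimeCount u r ≤ 48 * r + 426

-- Given c = coprimeCount u r, checks CountBound u at r, …, r + n - 1 and that the count
-- reaches 48 at r + n; carrying c along keeps the evaluation linear in n.
boundedFrom : ℕ → ℕ → ℕ → ℕ → Bool
boundedFrom u r c zero    = c ≡ᵇ 48
boundedFrom u r c (suc n) =
  (210 * c ≤ᵇ 48 * r + 426) ∧ boundedFrom u (suc r) (𝟙 (coprimeTo210ᵇ (1 + suc r * u)) + c) n

boundedFrom-sound : ∀ u r n → T (boundedFrom u r (coprimeCount u r) n) →
                    (∀ {s} → r ≤ s → s < n + r → CountBound u s) × coprimeCount u (n + r) ≡ 48
boundedFrom-sound u r zero    check = (λ r≤s s<r → contradiction s<r (≤⇒≯ r≤s)) , ≡ᵇ⇒≡ _ _ check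
boundedFrom-sound u r (suc n) check with Equivalence.to T-∧ check
... | here , rest with boundedFrom-sound u (suc r) n rest
...   | later , count≡48 = bounded , trans (cong (coprimeCount u) (sym (+-suc n r))) count≡48
  where
  bounded : ∀ {s} → r ≤ s → s < suc n + r → CountBound u s
  bounded {s} r≤s s<1+n+r with m≤n⇒m<n∨m≡n r≤s
  ... | inj₁ r<s  = later r<s (subst (s <_) (sym (+-suc n r)) s<1+n+r)
  ... | inj₂ refl = ≤ᵇ⇒≤ _ _ here

coprimeCount-table : ∀ {u} → u < 210 → T (coprimeTo210ᵇ u) → T (boundedFrom u 0 0 210)
coprimeCount-table = toWitness {a? = allUpTo? (λ u → T? (coprimeTo210ᵇ u) →-dec T? (boundedFrom u 0 0 210)) 210} tt

coprimeCount-bound : ∀ {u} → T (coprimeTo210ᵇ u) → ∀ r → 210 * coprimeCount u r ≤ 48 * r + 426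
coprimeCount-bound {u} u-coprime r = begin
  210 * coprimeCount u r                      ≡⟨ cong (210 *_) (coprimeCount-%210 u r) ⟩
  210 * coprimeCount u′ r                     ≡⟨ cong (λ r → 210 * coprimeCount u′ r) r≡t*210+s ⟩
  210 * coprimeCount u′ (t * 210 + s)         ≡⟨ cong (210 *_) (coprimeCount-periodic u′ count≡48 t s) ⟩
  210 * (t * 48 + coprimeCount u′ s)          ≡⟨ *-distribˡ-+ 210 (t * 48) _ ⟩
  210 * (t * 48) + 210 * coprimeCount u′ s    ≤⟨ +-monoʳ-≤ (210 * (t * 48)) (bounded z≤n (m%n<n r 210)) ⟩
  210 * (t * 48) + (48 * s + 426)             ≡⟨ regroup t s ⟩
  48 * (t * 210 + s) + 426                    ≡⟨ cong (λ r → 48 * r + 426) r≡t*210+s ⟨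
  48 * r + 426                                ∎
  where
  open ≤-Reasoning
  u′ = u % 210
  t  = r / 210
  s  = r % 210
  r≡t*210+s : r ≡ t * 210 + s
  r≡t*210+s = trans (m≡m%n+[m/n]*n r 210) (+-comm s (t * 210))
  u′-coprime : T (coprimeTo210ᵇ u′)
  u′-coprime = subst T (coprimeTo210ᵇ-%210 u) u-coprime
  table = boundedFrom-sound u′ 0 210 (coprimeCount-table (m%n<n u 210) u′-coprime)
  bounded = proj₁ table
  count≡48 = proj₂ table
  regroup : ∀ t s → 210 * (t * 48) + (48 * s + 426) ≡ 48 * (t * 210 + s) + 426
  regroup = solve-∀

[1+m]/n≡1+m/n : ∀ {m n} .{{_ : NonZero n}} → n ∣ suc m → suc m / n ≡ suc (m / n)
[1+m]/n≡1+m/n {m} {n} n∣1+m = ≤-antisym upper lower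
  where
  open ≤-Reasoning
  lower : m / n < suc m / n
  lower = m<n*o⇒m/o<n (subst (m <_) (sym (m/n*n≡m n∣1+m)) (n<1+n m))
  upper : suc m / n ≤ suc (m / n)
  upper = begin
    suc m / n      ≤⟨ /-monoˡ-≤ n (m<m+n m (>-nonZero⁻¹ n)) ⟩
    (m + n) / n    ≡⟨ +-distrib-/-∣ʳ m ∣-refl ⟩
    m / n + n / n  ≡⟨ cong (m / n +_) (n/n≡1 n) ⟩
    m / n + 1      ≡⟨ +-comm (m / n) 1 ⟩
    suc (m / n)    ∎

primesCount≤coprimeCount : ∀ {Q} .{{_ : NonZero Q}} → 7 ≤ Q → ∀ n →
                           primesCount Q (suc n) ≤ coprimeCount Q (n / Q)
primesCount≤coprimeCount Q≥7 zero = z≤n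
primesCount≤coprimeCount {Q} Q≥7 (suc n) with prime? (suc (suc n))
... | no _ = ≤-trans (primesCount≤coprimeCount Q≥7 n) (coprimeCount-mono Q (/-monoˡ-≤ Q (n≤1+n n)))
... | yes p with Q ∣? suc n
...   | no _ = ≤-trans (primesCount≤coprimeCount Q≥7 n) (coprimeCount-mono Q (/-monoˡ-≤ Q (n≤1+n n)))
...   | yes Q∣1+n = begin
  1 + primesCount Q (suc n)    ≤⟨ s≤s (primesCount≤coprimeCount Q≥7 n) ⟩
  1 + coprimeCount Q (n / Q)   ≡⟨ cong (_+ coprimeCount Q (n / Q)) (cong 𝟙 (Equivalence.to T-≡ coprime)) ⟨
  coprimeCount Q (suc (n / Q)) ≡⟨ cong (coprimeCount Q) ([1+m]/n≡1+m/n Q∣1+n) ⟨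
  coprimeCount Q (suc n / Q)   ∎
  where
  open ≤-Reasoning
  p≡1+[1+n/Q]*Q : suc (suc n) ≡ 1 + suc (n / Q) * Q
  p≡1+[1+n/Q]*Q = cong suc (trans (sym (m/n*n≡m Q∣1+n)) (cong (_* Q) ([1+m]/n≡1+m/n Q∣1+n)))
  coprime : T (coprimeTo210ᵇ (1 + suc (n / Q) * Q))
  coprime = subst (T ∘ coprimeTo210ᵇ) p≡1+[1+n/Q]*Q (coprimeTo210ᵇ-prime p (s≤s (≤-trans Q≥7 (∣⇒≤ Q∣1+n))))

primesCount-bound : ∀ {Q} .{{_ : NonZero Q}} → 7 ≤ Q → T (coprimeTo210ᵇ Q) → ∀ n →
                    210 * primesCount Q (suc n) ≤ 48 * (n / Q) + 426
primesCount-bound Q≥7 Q-coprime n =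
  ≤-trans (*-monoʳ-≤ 210 (primesCount≤coprimeCount Q≥7 n)) (coprimeCount-bound Q-coprime (n / _))

-- Instance search cannot find NonZero (q ^ j) (it cannot invert _^_), so it is supplied here.
⌊_/_^_⌋ : ℕ → (q : ℕ) .{{_ : NonZero q}} → ℕ → ℕ
⌊ n / q ^ j ⌋ = (n / q ^ j) {{m^n≢0 q j}}

module _ {q : ℕ} .{{_ : NonZero q}} where

  ∑[n/q^j]-bound : ∀ J n → (q ∸ 1) * ∑[ j < J ] ⌊ n / q ^ suc (toℕ j) ⌋ + ⌊ n / q ^ J ⌋ ≤ n
  ∑[n/q^j]-bound zero    n = ≤-reflexive (trans (cong (_+ n / 1) (*-zeroʳ (q ∸ 1))) (n/1≡n n))
  ∑[n/q^j]-bound (suc J) n = begin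
    (q ∸ 1) * (⌊ n / q ^ 1 ⌋ + ∑[ j < J ] ⌊ n / q ^ suc (suc (toℕ j)) ⌋) + ⌊ n / q ^ suc J ⌋
      ≡⟨ cong₂ (λ x y → (q ∸ 1) * (x + y) + ⌊ n / q ^ suc J ⌋)
           (trans (/q^suc 0) (n/1≡n s)) (sum-cong-≗ {J} (/q^suc ∘ suc ∘ toℕ)) ⟩
    (q ∸ 1) * (s + S) + ⌊ n / q ^ suc J ⌋
      ≡⟨ cong ((q ∸ 1) * (s + S) +_) (/q^suc J) ⟩
    (q ∸ 1) * (s + S) + ⌊ s / q ^ J ⌋
      ≡⟨ regroup (q ∸ 1) s S ⌊ s / q ^ J ⌋ ⟩
    (q ∸ 1) * s + ((q ∸ 1) * S + ⌊ s / q ^ J ⌋)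
      ≤⟨ +-monoʳ-≤ ((q ∸ 1) * s) (∑[n/q^j]-bound J s) ⟩
    (q ∸ 1) * s + s
      ≡⟨ +-comm ((q ∸ 1) * s) s ⟩
    suc (q ∸ 1) * s
      ≡⟨ cong (_* s) (suc-pred q) ⟩
    q * s
      ≤⟨ subst (_≤ n) (*-comm s q) (m/n*n≤m n q) ⟩
    n ∎
    where
    open ≤-Reasoning
    s = n / q
    S = ∑[ j < J ] ⌊ s / q ^ suc (toℕ j) ⌋
    /q^suc : ∀ j → ⌊ n / q ^ suc j ⌋ ≡ ⌊ s / q ^ j ⌋
    /q^suc j = sym (m/n/o≡m/[n*o] n q (q ^ j) {{_}} {{m^n≢0 q j}} {{m^n≢0 q (suc j)}})
    regroup : ∀ c s S t → c * (s + S) + t ≡ c * s + (c * S + t)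
    regroup = solve-∀

n<m^n : ∀ {m} → 1 < m → ∀ n → n < m ^ n
n<m^n 1<m zero    = z<s
n<m^n {m} 1<m (suc n) = begin-strict
  suc n      ≤⟨ n<m^n 1<m n ⟩
  m ^ n      <⟨ m<m*n (m ^ n) m 1<m ⟩
  m ^ n * m  ≡⟨ *-comm (m ^ n) m ⟩
  m ^ suc n  ∎
  where
  open ≤-Reasoning
  instance _ = m^n≢0 m n {{>-nonZero (<-trans z<s 1<m)}}

floorLog : ∀ {q a} → 1 < q → 0 < a → ∃[ J ] q ^ J ≤ a × a < q ^ suc J
floorLog {q} {a} 1<q 0<a = search a (n<m^n 1<q a)
  where
  search : ∀ J → a < q ^ J → ∃[ j ] q ^ j ≤ a × a < q ^ suc j
  search zero    a<1 = contradiction a<1 (≤⇒≯ 0<a)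
  search (suc J) a<qᴶ⁺¹ with a <? q ^ J
  ... | yes a<qᴶ = search J a<qᴶ
  ... | no  a≮qᴶ = J , ≮⇒≥ a≮qᴶ , a<qᴶ⁺¹

valBound-intro : ∀ {q a k J S} .{{_ : NonZero q}} → q ^ J ≤ a →
                 210 * k ≤ 48 * S + J * 426 → (q ∸ 1) * S ≤ a → ValBound q a k
valBound-intro {q} {a} {k} {J} {S} qᴶ≤a k-bound S-bound = inj₂ (begin
  q ^ (X ∸ 23 * a)       ≤⟨ ^-monoʳ-≤ q (m≤n+o⇒m∸n≤o X (23 * a) X≤23a+W) ⟩
  q ^ (700 * (c * J))    ≡⟨ cong (q ^_) (exponent c J) ⟩
  q ^ (J * E)            ≡⟨ ^-*-assoc q J E ⟨
  (q ^ J) ^ E            ≤⟨ ^-monoˡ-≤ E qᴶ≤a ⟩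
  a ^ E                  ∎)
  where
  open ≤-Reasoning
  c = q ∸ 1
  X = 100 * c * k
  E = 7 * (100 * c)
  exponent : ∀ c J → 700 * (c * J) ≡ J * (7 * (100 * c))
  exponent = solve-∀
  X≤23a+W : X ≤ 23 * a + 700 * (c * J)
  X≤23a+W = *-cancelˡ-≤ 210 (begin
    210 * X                                          ≡⟨ e₁ c k ⟩
    100 * (c * (210 * k))                             ≤⟨ *-monoʳ-≤ 100 (*-monoʳ-≤ c k-bound) ⟩
    100 * (c * (48 * S + J * 426))                    ≡⟨ e₂ c S J ⟩
    4800 * (c * S) + 42600 * (c * J)                  ≤⟨ +-monoˡ-≤ _ (*-monoʳ-≤ 4800 S-bound) ⟩
    4800 * a + 42600 * (c * J)                        ≤⟨ m≤m+n _ (30 * a + 104400 * (c * J)) ⟩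
    4800 * a + 42600 * (c * J) + (30 * a + 104400 * (c * J)) ≡⟨ e₃ a (c * J) ⟩
    210 * (23 * a + 700 * (c * J))                    ∎)
    where
    e₁ : ∀ c k → 210 * (100 * c * k) ≡ 100 * (c * (210 * k))
    e₁ = solve-∀
    e₂ : ∀ c S J → 100 * (c * (48 * S + J * 426)) ≡ 4800 * (c * S) + 42600 * (c * J)
    e₂ = solve-∀
    e₃ : ∀ a w → 4800 * a + 42600 * w + (30 * a + 104400 * w) ≡ 210 * (23 * a + 700 * w)
    e₃ = solve-∀

module _ {q : ℕ} (q-prime : Prime q) (7<q : 7 < q) where

  private instance
    q-nonZero : NonZero q
    q-nonZero = prime⇒nonZero q-prime

  ∑-primesCount-bound : ∀ J n →
    210 * ∑[ j < J ] primesCount (q ^ suc (toℕ j)) (suc n) ≤ 48 * ∑[ j < J ] ⌊ n / q ^ suc (toℕ j) ⌋ + J * 426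
  ∑-primesCount-bound J n = begin
    210 * ∑[ j < J ] count j           ≡⟨ *-distribˡ-sum 210 count ⟩
    ∑[ j < J ] (210 * count j)         ≤⟨ sum-mono-≤ count-bound ⟩
    ∑[ j < J ] (48 * quot j + 426)     ≡⟨ ∑-distrib-+ (λ j → 48 * quot j) (λ _ → 426) ⟩
    ∑[ j < J ] (48 * quot j) + ∑[ j < J ] 426 ≡⟨ cong₂ _+_ (sym (*-distribˡ-sum 48 quot)) (sum-const J 426) ⟩
    48 * ∑[ j < J ] quot j + J * 426  ∎
    where
    open ≤-Reasoning
    count quot : Fin J → ℕ
    count j = primesCount (q ^ suc (toℕ j)) (suc n)
    quot  j = ⌊ n / q ^ suc (toℕ j) ⌋
    count-bound : ∀ j → 210 * count j ≤ 48 * quot j + 426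
    count-bound j = primesCount-bound {{m^n≢0 q (suc (toℕ j))}}
      (≤-trans (<⇒≤ 7<q) (m≤m*n q (q ^ toℕ j) {{m^n≢0 q (toℕ j)}}))
      (coprimeTo210ᵇ-prime^ q-prime 7<q (suc (toℕ j))) n

lemma5p1 : (q a : ℕ) → Prime q → 7 < q → 0 < a →
    (k : ℕ) → IsValuation q (primeProd a) k → ValBound q a k
lemma5p1 q a@(suc n) q-prime 7<q 0<a k (qᵏ∣∏ , _) =
  let J , qᴶ≤a , a<qᴶ⁺¹ = floorLog (≤-trans (s≤s (s≤s z≤n)) 7<q) 0<a
      instance _ = prime⇒nonZero q-prime
  in valBound-intro {J = J} qᴶ≤a
       (≤-trans (*-monoʳ-≤ 210 (primeProd-valuationAtMost q-prime J a a<qᴶ⁺¹ k qᵏ∣∏))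
                (∑-primesCount-bound q-prime 7<q J n))
       (≤-trans (m≤m+n _ _) (≤-trans (∑[n/q^j]-bound J n) (n≤1+n n)))
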